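{- Let $F$ be a graph in which every vertex has a non-neighbor (in particular, any graph $F$ with an isolated vertex). Then $\overline{\mathrm{ex}}(n,F)\ge n/2$ for every $n\ge |V(F)|$.
   Context: All graphs are simple and undirected. For graphs $F$ and $G$, an induced $F$-decomposition of $G$ is a collection $\{F_1,\dots,F_\ell\}$ of induced subgraphs of $G$, each isomorphic to $F$, which are pairwise edge-disjoint and whose edge sets together cover $E(G)$. For $n\ge |V(F)|$, $\mathrm{ex}(n,F)$ denotes the maximum number of edges in a graph of order $n$ admitting an induced $F$-decomposition, and $\overline{\mathrm{ex}}(n,F)=\binom{n}{2}-\mathrm{ex}(n,F)$. A non-neighbor of a vertex $v$ is a vertex $u\neq v$ not adjacent to $v$. -}

module Defs where

open import Data.Nat using (ℕ; zero; suc; _<_)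
open import Data.Bool using (Bool; true; false)
open import Data.Fin using (Fin; toℕ)
open import Data.List using (List; length; filter; allFin; concatMap; map)
open import Data.Product using (_×_; _,_; Σ; ∃; ∃-syntax)
open import Relation.Binary.PropositionalEquality using (_≡_; _≢_)
open import Relation.Nullary using (¬_; Dec; yes; no)
open import Data.Nat.Properties using (_<?_)
open import Data.Bool.Properties using () renaming (_≟_ to _≟ᵇ_)
open import Relation.Nullary.Decidable using (_×-dec_)
open import Function.Definitions using (Injective)

record Graph (n : ℕ) : Set where
  field
    adj   : Fin n → Fin n → Bool
    sym   : ∀ u v → adj u v ≡ adj v u
    irrefl : ∀ u → adj u u ≡ false
open Graph public

Adj : ∀ {n} → Graph n → Fin n → Fin n → Set
Adj G u v = adj G u v ≡ true

EveryVertexHasNonNeighbor : ∀ {m} → Graph m → Set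
EveryVertexHasNonNeighbor {m} F = ∀ (v : Fin m) → ∃[ u ] (u ≢ v × ¬ Adj F u v)

-- Edge set: unordered pairs {i,j} represented as (i , j) with toℕ i < toℕ j.

edgeList : ∀ {n} → Graph n → List (Fin n × Fin n)
edgeList {n} G =
  filter (λ p → (toℕ (Data.Product.proj₁ p) <? toℕ (Data.Product.proj₂ p))
                 ×-dec (adj G (Data.Product.proj₁ p) (Data.Product.proj₂ p) ≟ᵇ true))
         (concatMap (λ i → map (λ j → (i , j)) (allFin n)) (allFin n))

numEdges : ∀ {n} → Graph n → ℕ
numEdges G = length (edgeList G)

-- An induced copy of F in G: an injective map of vertices preserving both
-- adjacency and non-adjacency (so its image induces a subgraph isomorphic to F).
record InducedCopy {m n : ℕ} (F : Graph m) (G : Graph n) : Set where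
  field
    emb     : Fin m → Fin n
    inj     : Injective _≡_ _≡_ emb
    induced : ∀ a b → adj G (emb a) (emb b) ≡ adj F a b
open InducedCopy public

EdgeIn : ∀ {m n} {F : Graph m} {G : Graph n} → InducedCopy F G → Fin n → Fin n → Set
EdgeIn {F = F} c u v = ∃[ a ] ∃[ b ] (emb c a ≡ u × emb c b ≡ v × Adj F a b)

record InducedDecomposition {m n : ℕ} (F : Graph m) (G : Graph n) : Set where
  field
    size     : ℕ
    copies   : Fin size → InducedCopy F G
    disjoint : ∀ k l → k ≢ l → ∀ u v →
               ¬ (EdgeIn (copies k) u v × EdgeIn (copies l) u v)
    covers   : ∀ u v → Adj G u v → ∃[ k ] EdgeIn (copies k) u v

-- The argument has a graph-theoretic half and a counting half.
--   * Transfer: every vertex v of G has a non-neighbour.  F has at least two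
--     vertices, hence so does G; if v is isolated, any other vertex will do;
--     otherwise v lies on an edge covered by an induced copy of F, and the
--     image of a non-neighbour (in F) of v's preimage is a non-neighbour of v.
--   * Handshake: if every vertex of G has a non-neighbour, the complement of G
--     has minimum degree ≥ 1, so it has at least n/2 edges.
module Submission where

open import Defs
open import Data.Nat using (ℕ; suc; _≤_; _*_; _∸_)
open import Data.Nat.Combinatorics using (_C_)

open import Data.Nat using (zero; _+_; _<_; z≤n; s≤s)
open import Data.Nat.Properties
  using (_<?_; +-0-commutativeMonoid; module ≤-Reasoning; ≤-trans; m≤m+n; m≤n+m; +-mono-≤; +-identityʳ; m+n∸m≡n)
open import Data.Nat.Combinatorics using (nCk+nC[k+1]≡[n+1]C[k+1]; nC1≡n)
open import Algebra.Properties.CommutativeMonoid.Sum +-0-commutativeMonoid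
  using (sum-syntax; ∑-distrib-+; ∑-comm; sum-cong-≗)
open import Data.Bool using (Bool; true; false; _∧_; not)
open import Data.Bool.Properties using (¬-not) renaming (_≟_ to _≟ᵇ_)
open import Data.Fin using (Fin; zero; suc; toℕ; punchIn)
open import Data.Fin.Properties using (<-cmp; punchInᵢ≢i; any?)
open import Data.List using (List; _++_; filter; length; tabulate; concatMap; map; allFin)
open import Data.List.Properties using (filter-++; length-++; map-tabulate)
open import Data.Product using (_×_; _,_; ∃-syntax)
open import Data.Sum using (_⊎_; inj₁; inj₂)
open import Function using (_∘_)
open import Relation.Binary.Definitions using (tri<; tri≈; tri>)
open import Relation.Binary.PropositionalEquality
  using (_≡_; _≢_; refl; trans; cong; cong₂; subst; module ≡-Reasoning)
  renaming (sym to ≡-sym)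
open import Relation.Nullary using (yes; no; does; ¬_; contradiction)
open import Relation.Nullary.Decidable using (dec-true; _×-dec_)
open import Relation.Unary using (Pred; Decidable)

χ : Bool → ℕ
χ true  = 1
χ false = 0

χ-split : ∀ a b → χ (a ∧ b) + χ (a ∧ not b) ≡ χ a
χ-split true  true  = refl
χ-split true  false = refl
χ-split false b     = refl

χ-either : ∀ {a b r s} → a ≡ true ⊎ b ≡ true → r ≡ true → s ≡ true →
           1 ≤ χ (a ∧ r) + χ (b ∧ s)
χ-either (inj₁ refl) refl _ = s≤s z≤n
χ-either {a} (inj₂ refl) _ refl = m≤n+m 1 (χ (a ∧ _))

∑-≥-term : ∀ {n} (f : Fin n → ℕ) (i : Fin n) → f i ≤ ∑[ k < n ] f k
∑-≥-term f zero    = m≤m+n (f zero) _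
∑-≥-term f (suc i) = ≤-trans (∑-≥-term (f ∘ suc) i) (m≤n+m _ (f zero))

∑-≥-length : ∀ {n} (f : Fin n → ℕ) → (∀ i → 1 ≤ f i) → n ≤ ∑[ k < n ] f k
∑-≥-length {zero}  f pos = z≤n
∑-≥-length {suc n} f pos = +-mono-≤ (pos zero) (∑-≥-length (f ∘ suc) (pos ∘ suc))

∑-ones : ∀ n → ∑[ k < n ] 1 ≡ n
∑-ones zero    = refl
∑-ones (suc n) = cong suc (∑-ones n)

∑∑-≥-rows : ∀ {m n} (f : Fin m → Fin n → ℕ) → (∀ i → ∃[ j ] 1 ≤ f i j) →
            m ≤ ∑[ i < m ] ∑[ j < n ] f i j
∑∑-≥-rows f row = ∑-≥-length _ λ i → let (j , 1≤fij) = row i in ≤-trans 1≤fij (∑-≥-term (f i) j)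

∑∑-distrib-+ : ∀ {m n} (f g : Fin m → Fin n → ℕ) →
               ∑[ i < m ] ∑[ j < n ] (f i j + g i j) ≡
               ∑[ i < m ] ∑[ j < n ] f i j + ∑[ i < m ] ∑[ j < n ] g i j
∑∑-distrib-+ {n = n} f g =
  trans (sum-cong-≗ λ i → ∑-distrib-+ (f i) (g i))
        (∑-distrib-+ (λ i → ∑[ j < n ] f i j) (λ i → ∑[ j < n ] g i j))

_≺_ : ∀ {n} → Fin n → Fin n → Bool
i ≺ j = does (toℕ i <? toℕ j)

-- In Fin (suc n) the pairs with i = 0
-- contribute n, and the remaining ones are the pairs of Fin n shifted by one;
-- both facts hold by computation, and C(n+1,2) = C(n,1) + C(n,2).
∑∑-≺ : ∀ n → ∑[ i < n ] ∑[ j < n ] χ (i ≺ j) ≡ n C 2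
∑∑-≺ zero    = refl
∑∑-≺ (suc n) = begin
  ∑[ j < n ] 1 + ∑[ i < n ] ∑[ j < n ] χ (i ≺ j)  ≡⟨ cong₂ _+_ (∑-ones n) (∑∑-≺ n) ⟩
  n + n C 2                                      ≡⟨ cong (_+ n C 2) (≡-sym (nC1≡n n)) ⟩
  n C 1 + n C 2                                  ≡⟨ nCk+nC[k+1]≡[n+1]C[k+1] n 1 ⟩
  suc n C 2                                      ∎
  where open ≡-Reasoning

pairsWith : ∀ {n} → (Fin n → Fin n → Bool) → ℕ
pairsWith {n} R = ∑[ i < n ] ∑[ j < n ] χ (i ≺ j ∧ R i j)

pairsWith-complement : ∀ {n} (R : Fin n → Fin n → Bool) →
                       pairsWith R + pairsWith (λ i j → not (R i j)) ≡ n C 2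
pairsWith-complement {n} R = begin
  pairsWith R + pairsWith (λ i j → not (R i j))
    ≡⟨ ≡-sym (∑∑-distrib-+ (λ i j → χ (i ≺ j ∧ R i j)) (λ i j → χ (i ≺ j ∧ not (R i j)))) ⟩
  ∑[ i < n ] ∑[ j < n ] (χ (i ≺ j ∧ R i j) + χ (i ≺ j ∧ not (R i j)))
    ≡⟨ sum-cong-≗ (λ i → sum-cong-≗ λ j → χ-split (i ≺ j) (R i j)) ⟩
  ∑[ i < n ] ∑[ j < n ] χ (i ≺ j)
    ≡⟨ ∑∑-≺ n ⟩
  n C 2 ∎
  where open ≡-Reasoning

≺-total : ∀ {n} {i j : Fin n} → j ≢ i → i ≺ j ≡ true ⊎ j ≺ i ≡ true
≺-total {i = i} {j} j≢i with <-cmp i j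
... | tri< i<j _ _ = inj₁ (dec-true (toℕ i <? toℕ j) i<j)
... | tri≈ _ i≡j _ = contradiction (≡-sym i≡j) j≢i
... | tri> _ _ j<i = inj₂ (dec-true (toℕ j <? toℕ i) j<i)

-- Each pair is counted once from
-- each of its two ends, so 2 · pairsWith R is a sum of "degrees", each ≥ 1.
pairsWith-≥-half : ∀ {n} (R : Fin n → Fin n → Bool) → (∀ i j → R i j ≡ R j i) →
                   (∀ i → ∃[ j ] (j ≢ i × R i j ≡ true)) → n ≤ 2 * pairsWith R
pairsWith-≥-half {n} R R-sym partner = begin
  n
    ≤⟨ ∑∑-≥-rows (λ i j → χ (i ≺ j ∧ R i j) + χ (j ≺ i ∧ R j i)) degree-positive ⟩
  ∑[ i < n ] ∑[ j < n ] (χ (i ≺ j ∧ R i j) + χ (j ≺ i ∧ R j i))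
    ≡⟨ ∑∑-distrib-+ (λ i j → χ (i ≺ j ∧ R i j)) (λ i j → χ (j ≺ i ∧ R j i)) ⟩
  pairsWith R + ∑[ i < n ] ∑[ j < n ] χ (j ≺ i ∧ R j i)
    ≡⟨ cong (pairsWith R +_) (≡-sym (∑-comm (λ j i → χ (j ≺ i ∧ R j i)))) ⟩
  pairsWith R + pairsWith R
    ≡⟨ cong (pairsWith R +_) (≡-sym (+-identityʳ (pairsWith R))) ⟩
  2 * pairsWith R ∎
  where
  open ≤-Reasoning
  degree-positive : ∀ i → ∃[ j ] 1 ≤ χ (i ≺ j ∧ R i j) + χ (j ≺ i ∧ R j i)
  degree-positive i = let (j , j≢i , Rij) = partner i in
    j , χ-either (≺-total j≢i) Rij (trans (R-sym j i) Rij)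

length-filter-tabulate : ∀ {a p} {A : Set a} {P : Pred A p} (P? : Decidable P)
                         {n} (f : Fin n → A) →
                         length (filter P? (tabulate f)) ≡ ∑[ i < n ] χ (does (P? (f i)))
length-filter-tabulate P? {zero}  f = refl
length-filter-tabulate P? {suc n} f with does (P? (f zero))
... | true  = cong suc (length-filter-tabulate P? (f ∘ suc))
... | false = length-filter-tabulate P? (f ∘ suc)

length-filter-concatMap : ∀ {a b p} {A : Set a} {B : Set b} {P : Pred A p}
                          (P? : Decidable P) (g : B → List A) {n} (f : Fin n → B) →
                          length (filter P? (concatMap g (tabulate f))) ≡
                          ∑[ i < n ] length (filter P? (g (f i)))
length-filter-concatMap P? g {zero}  f = refl
length-filter-concatMap P? g {suc n} f = begin
  length (filter P? (g (f zero) ++ concatMap g (tabulate (f ∘ suc))))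
    ≡⟨ cong length (filter-++ P? (g (f zero)) _) ⟩
  length (filter P? (g (f zero)) ++ filter P? (concatMap g (tabulate (f ∘ suc))))
    ≡⟨ length-++ (filter P? (g (f zero))) ⟩
  length (filter P? (g (f zero))) + length (filter P? (concatMap g (tabulate (f ∘ suc))))
    ≡⟨ cong (length (filter P? (g (f zero))) +_) (length-filter-concatMap P? g (f ∘ suc)) ⟩
  length (filter P? (g (f zero))) + ∑[ i < n ] length (filter P? (g (f (suc i)))) ∎
  where open ≡-Reasoning

does-≟true : ∀ b → does (b ≟ᵇ true) ≡ b
does-≟true true  = refl
does-≟true false = refl

numEdges≡pairsWith : ∀ {n} (G : Graph n) → numEdges G ≡ pairsWith (adj G)
numEdges≡pairsWith {n} G = begin
  length (filter isEdge? (concatMap row (allFin n)))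
    ≡⟨ length-filter-concatMap isEdge? row (λ i → i) ⟩
  ∑[ i < n ] length (filter isEdge? (map (i ,_) (allFin n)))
    ≡⟨ sum-cong-≗ (λ i → cong (length ∘ filter isEdge?) (map-tabulate (λ j → j) (i ,_))) ⟩
  ∑[ i < n ] length (filter isEdge? (tabulate (i ,_)))
    ≡⟨ sum-cong-≗ (λ i → length-filter-tabulate isEdge? (i ,_)) ⟩
  ∑[ i < n ] ∑[ j < n ] χ (i ≺ j ∧ does (adj G i j ≟ᵇ true))
    ≡⟨ sum-cong-≗ (λ i → sum-cong-≗ λ j → cong (λ b → χ (i ≺ j ∧ b)) (does-≟true (adj G i j))) ⟩
  pairsWith (adj G) ∎
  where
  open ≡-Reasoning
  row : Fin n → List (Fin n × Fin n)
  row i = map (i ,_) (allFin n)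
  isEdge? : Decidable λ ((i , j) : Fin n × Fin n) → toℕ i < toℕ j × adj G i j ≡ true
  isEdge? (i , j) = (toℕ i <? toℕ j) ×-dec (adj G i j ≟ᵇ true)

nonEdges-≥-half : ∀ {n} (G : Graph n) → EveryVertexHasNonNeighbor G →
                  n ≤ 2 * ((n C 2) ∸ numEdges G)
nonEdges-≥-half {n} G nonNeighbour = begin
  n
    ≤⟨ pairsWith-≥-half nonAdj (λ i j → cong not (Graph.sym G i j)) partner ⟩
  2 * pairsWith nonAdj
    ≡⟨ cong (2 *_) (≡-sym (m+n∸m≡n (pairsWith (adj G)) (pairsWith nonAdj))) ⟩
  2 * (pairsWith (adj G) + pairsWith nonAdj ∸ pairsWith (adj G))
    ≡⟨ cong₂ (λ total edges → 2 * (total ∸ edges))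
             (pairsWith-complement (adj G)) (≡-sym (numEdges≡pairsWith G)) ⟩
  2 * ((n C 2) ∸ numEdges G) ∎
  where
  open ≤-Reasoning
  nonAdj : Fin n → Fin n → Bool
  nonAdj i j = not (adj G i j)
  partner : ∀ i → ∃[ j ] (j ≢ i × nonAdj i j ≡ true)
  partner i = let (j , j≢i , ¬adj) = nonNeighbour i in
    j , j≢i , cong not (trans (Graph.sym G i j) (¬-not ¬adj))

twoVertices : ∀ {m} (F : Graph (suc m)) → EveryVertexHasNonNeighbor F → 2 ≤ suc m
twoVertices {zero}  F nonNeighbour with nonNeighbour zero
... | zero , 0≢0 , _ = contradiction refl 0≢0
twoVertices {suc m} F nonNeighbour = s≤s (s≤s z≤n)

otherVertex : ∀ {n} → 2 ≤ n → (v : Fin n) → ∃[ u ] u ≢ v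
otherVertex (s≤s (s≤s _)) v = punchIn v zero , punchInᵢ≢i v zero

-- The image of a vertex of an induced copy of F has a non-neighbour in G,
-- namely the image of its non-neighbour in F (distinct by injectivity,
-- non-adjacent because the copy is induced).
copy-nonNeighbour : ∀ {m n} {F : Graph m} {G : Graph n} (c : InducedCopy F G) →
                    EveryVertexHasNonNeighbor F →
                    ∀ b → ∃[ u ] (u ≢ emb c b × ¬ Adj G u (emb c b))
copy-nonNeighbour c nonNeighbour b = let (a , a≢b , ¬Fab) = nonNeighbour b in
  emb c a , a≢b ∘ inj c , λ Gab → ¬Fab (trans (≡-sym (induced c a b)) Gab)

decomposition-nonNeighbour : ∀ {m n} {F : Graph m} {G : Graph n} → 2 ≤ n →
                             InducedDecomposition F G →
                             EveryVertexHasNonNeighbor F → EveryVertexHasNonNeighbor G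
decomposition-nonNeighbour {G = G} 2≤n D nonNeighbour v
  with any? (λ u → adj G u v ≟ᵇ true)
... | yes (u , uv) = let (k , a , b , _ , b↦v , _) = InducedDecomposition.covers D u v uv in
  subst (λ w → ∃[ u ] (u ≢ w × ¬ Adj G u w)) b↦v
        (copy-nonNeighbour (InducedDecomposition.copies D k) nonNeighbour b)
... | no isolated = let (u , u≢v) = otherVertex 2≤n v in
  u , u≢v , λ uv → isolated (u , uv)

proposition1 : ∀ {m} (F : Graph (suc m)) → EveryVertexHasNonNeighbor F →
               ∀ n → suc m ≤ n → (G : Graph n) → InducedDecomposition F G →
               n ≤ 2 * ((n C 2) ∸ numEdges G)
proposition1 F nonNeighbour n |F|≤n G D =
  nonEdges-≥-half G (decomposition-nonNeighbour 2≤n D nonNeighbour)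
  where
  2≤n : 2 ≤ n
  2≤n = ≤-trans (twoVertices F nonNeighbour) |F|≤n
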